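{- Let $\lambda\in\mathbb{R}$ and let $k\geq 0$ be an integer. Then $$\Big(\frac{1}{x}\Big)^{k+1}=\sum_{n=k}^{\infty}(-1)^{n-k}S_{1,\lambda}(n,k)\,\frac{1}{x(x+\lambda)\cdots(x+n\lambda)}=\sum_{n=k}^{\infty}{n \brack k}_{\lambda}\,\frac{1}{x(x+\lambda)\cdots(x+n\lambda)},$$ as an identity of expansions in powers of $1/x$ (each term $\frac{1}{x(x+\lambda)\cdots(x+n\lambda)}$ being expanded in powers of $1/x$; it begins with $x^{ -(n+1)}$).
   Context: For $\lambda\in\mathbb{R}$, the generalized falling factorial is $(x)_{0,\lambda}=1$, $(x)_{n,\lambda}=x(x-\lambda)\cdots(x-(n-1)\lambda)$ for $n\ge1$, and the generalized rising factorial is $\langle x\rangle_{0,\lambda}=1$, $\langle x\rangle_{n,\lambda}=x(x+\lambda)\cdots(x+(n-1)\lambda)$ for $n\ge1$. The $\lambda$-Stirling numbers of the first kind $S_{1,\lambda}(n,k)$ are defined by $(x)_{n,\lambda}=\sum_{k=0}^{n}S_{1,\lambda}(n,k)x^k$, and the unsigned $\lambda$-Stirling numbers of the first kind by $\langle x\rangle_{n,\lambda}=(-1)^n(-x)_{n,\lambda}=\sum_{k=0}^n{n \brack k}_{\lambda}x^k$, so that ${n \brack k}_{\lambda}=(-1)^{n-k}S_{1,\lambda}(n,k)$. -}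

module Defs where

open import Level using (_⊔_)
open import Data.Nat using (ℕ; zero; suc; _∸_)
open import Algebra.Bundles using (CommutativeRing)

-- Formal power series (and polynomials, as finitely supported series)
-- over a commutative ring R, represented by their coefficient sequences.
module Series {c ℓ} (R : CommutativeRing c ℓ) where
  open CommutativeRing R

  Ser : Set c
  Ser = ℕ → Carrier

  _·_ : ℕ → Carrier → Carrier
  zero  · a = 0#
  suc n · a = a + (n · a)

  _^_ : Carrier → ℕ → Carrier
  a ^ zero  = 1#
  a ^ suc n = a * (a ^ n)

  Σ≤ : ℕ → (ℕ → Carrier) → Carrier
  Σ≤ zero    f = f 0
  Σ≤ (suc n) f = Σ≤ n f + f (suc n)

  -- finite sum  Σ_{i=k}^{N} f i  (empty, i.e. 0#, when N < k)
  ΣFromTo : ℕ → ℕ → (ℕ → Carrier) → Carrier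
  ΣFromTo k zero    f with k
  ... | zero  = f 0
  ... | suc _ = 0#
  ΣFromTo k (suc N) f = ΣFromTo k N f + ΣFromTo' k (suc N) f
    where
    -- include the term f (suc N) iff k ≤ suc N
    ΣFromTo' : ℕ → ℕ → (ℕ → Carrier) → Carrier
    ΣFromTo' zero    m g = g m
    ΣFromTo' (suc k) zero g = 0#
    ΣFromTo' (suc k) (suc m) g = ΣFromTo' k m (λ i → g (suc i))

  _⊛_ : Ser → Ser → Ser
  (f ⊛ g) m = Σ≤ m (λ i → f i * g (m ∸ i))

  one : Ser
  one zero    = 1#
  one (suc _) = 0#

  lin : Carrier → Carrier → Ser
  lin a b zero          = a
  lin a b (suc zero)    = b
  lin a b (suc (suc _)) = 0#

  mono : ℕ → Ser
  mono zero    zero    = 1#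
  mono zero    (suc _) = 0#
  mono (suc j) zero    = 0#
  mono (suc j) (suc m) = mono j m

  -- Polynomials in x (variable T = x)

  falling : Carrier → ℕ → Ser
  falling lam zero    = one
  falling lam (suc n) = falling lam n ⊛ lin (- (n · lam)) 1#

  rising : Carrier → ℕ → Ser
  rising lam zero    = one
  rising lam (suc n) = rising lam n ⊛ lin (n · lam) 1#

  S1 : Carrier → ℕ → ℕ → Carrier
  S1 lam n k = falling lam n k

  uS1 : Carrier → ℕ → ℕ → Carrier
  uS1 lam n k = rising lam n k

  -- Expansions in powers of y = 1/x (variable T = y)

  -- 1/(x + c) = y/(1 + c y) = Σ_m (-c)^m y^{m+1}
  invShift : Carrier → Ser
  invShift a zero    = 0#
  invShift a (suc m) = (- a) ^ m

  -- 1/(x(x+λ)...(x+nλ)) expanded in powers of y = 1/x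
  invRising : Carrier → ℕ → Ser
  invRising lam zero    = invShift (0 · lam)
  invRising lam (suc n) = invRising lam n ⊛ invShift (suc n · lam)

  -- Σ_{n ≥ k} a_n F_n for a family F_n of series with F_n of order ≥ n+1:
  -- the coefficient of y^N only receives contributions from n ≤ N,
  -- so it is the finite sum Σ_{n=k}^{N} a_n [y^N] F_n.
  sumFrom : ℕ → (ℕ → Carrier) → (ℕ → Ser) → Ser
  sumFrom k a F N = ΣFromTo k N (λ n → a n * F n N)

-- Write F n for the expansion of 1/(x(x+λ)⋯(x+nλ)) in y = 1/x and
-- G k = Σ_n [n,k]_λ F n.  Since F n has order n+1
-- and [n,k]_λ = 0 for n < k, each coefficient is a finite sum, and the sum may
-- start at n = 0.  G 0 = F 0 = y, as [n,0]_λ = 0 for n ≥ 1.  Multiplying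
-- [n+1,k+1] = [n,k] + nλ[n,k+1] by y F n = (1 + (n+1)λy) F (n+1) and summing
-- over n, the nλ-terms telescope and leave y G k = G (k+1).  The signed form
-- follows from [n,k]_λ = (−1)^(n−k) S₁,λ(n,k).
{-# OPTIONS --safe #-}
module Submission where

open import Defs
open import Data.Nat using (ℕ; zero; suc; _∸_; _≤_; _<_; z≤n; s≤s; _≤?_)
open import Data.Nat.Properties
  using (n∸n≡0; m+n∸n≡m; +-∸-assoc; ≤-refl; n≤1+n; m≤n⇒m≤1+n; m<n⇒m<1+n; ≰⇒>)
open import Data.Product using (_×_; _,_)
open import Algebra.Bundles using (CommutativeRing)
open import Relation.Binary.PropositionalEquality using (_≡_; cong)
open import Relation.Nullary using (yes; no)
import Algebra.Properties.Ring as RingProperties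
import Algebra.Properties.CommutativeSemigroup as CommutativeSemigroupProperties
import Relation.Binary.Reasoning.Setoid as SetoidReasoning

module _ {c ℓ} (R : CommutativeRing c ℓ) where
  open CommutativeRing R hiding (zero)
  open Series R
  open RingProperties ring using (-‿distribˡ-*; -‿distribʳ-*; -1*x≈-x; -‿involutive; -0#≈0#)
  open CommutativeSemigroupProperties +-commutativeSemigroup using (interchange; xy∙z≈xz∙y)
  open CommutativeSemigroupProperties *-commutativeSemigroup using (x∙yz≈y∙xz)
  open SetoidReasoning setoid

  ≈-at : ∀ (f : ℕ → Carrier) {m n} → m ≡ n → f m ≈ f n
  ≈-at f eq = reflexive (cong f eq)

  Σ≤-cong : ∀ n {f g : ℕ → Carrier} → (∀ i → i ≤ n → f i ≈ g i) → Σ≤ n f ≈ Σ≤ n g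
  Σ≤-cong zero    f≈g = f≈g 0 z≤n
  Σ≤-cong (suc n) f≈g = +-cong (Σ≤-cong n (λ i i≤n → f≈g i (m≤n⇒m≤1+n i≤n))) (f≈g (suc n) ≤-refl)

  Σ≤-zero : ∀ n {f : ℕ → Carrier} → (∀ i → i ≤ n → f i ≈ 0#) → Σ≤ n f ≈ 0#
  Σ≤-zero zero    f≈0 = f≈0 0 z≤n
  Σ≤-zero (suc n) f≈0 =
    trans (+-cong (Σ≤-zero n (λ i i≤n → f≈0 i (m≤n⇒m≤1+n i≤n))) (f≈0 (suc n) ≤-refl)) (+-identityʳ 0#)

  Σ≤-last : ∀ n {f : ℕ → Carrier} → (∀ i → i < n → f i ≈ 0#) → Σ≤ n f ≈ f n
  Σ≤-last zero    _   = refl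
  Σ≤-last (suc n) f≈0 = trans (+-congʳ (Σ≤-zero n (λ i i≤n → f≈0 i (s≤s i≤n)))) (+-identityˡ _)

  Σ≤-head : ∀ n (f : ℕ → Carrier) → Σ≤ (suc n) f ≈ f 0 + Σ≤ n (λ i → f (suc i))
  Σ≤-head zero    f = refl
  Σ≤-head (suc n) f = trans (+-congʳ (Σ≤-head n f)) (+-assoc _ _ _)

  Σ≤-first : ∀ n {f : ℕ → Carrier} → (∀ i → i < n → f (suc i) ≈ 0#) → Σ≤ n f ≈ f 0
  Σ≤-first zero    _   = refl
  Σ≤-first (suc n) f≈0 =
    trans (Σ≤-head n _) (trans (+-congˡ (Σ≤-zero n (λ i i≤n → f≈0 i (s≤s i≤n)))) (+-identityʳ _))

  Σ≤-+ : ∀ n (f g : ℕ → Carrier) → Σ≤ n (λ i → f i + g i) ≈ Σ≤ n f + Σ≤ n g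
  Σ≤-+ zero    f g = refl
  Σ≤-+ (suc n) f g = trans (+-congʳ (Σ≤-+ n f g)) (interchange _ _ _ _)

  *-distribˡ-Σ≤ : ∀ n x (f : ℕ → Carrier) → x * Σ≤ n f ≈ Σ≤ n (λ i → x * f i)
  *-distribˡ-Σ≤ zero    x f = refl
  *-distribˡ-Σ≤ (suc n) x f = trans (distribˡ _ _ _) (+-congʳ (*-distribˡ-Σ≤ n x f))

  Σ≤-telescope : ∀ n (f g h : ℕ → Carrier) → (∀ i → f i + h i ≈ g i + h (suc i)) →
                 Σ≤ n f + h 0 ≈ Σ≤ n g + h (suc n)
  Σ≤-telescope zero    f g h step = step 0
  Σ≤-telescope (suc n) f g h step = begin
    Σ≤ n f + f (suc n) + h 0        ≈⟨ xy∙z≈xz∙y _ _ _ ⟩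
    Σ≤ n f + h 0 + f (suc n)        ≈⟨ +-congʳ (Σ≤-telescope n f g h step) ⟩
    Σ≤ n g + h (suc n) + f (suc n)  ≈⟨ xy∙z≈xz∙y _ _ _ ⟩
    Σ≤ n g + f (suc n) + h (suc n)  ≈⟨ +-assoc _ _ _ ⟩
    Σ≤ n g + (f (suc n) + h (suc n)) ≈⟨ +-congˡ (step (suc n)) ⟩
    Σ≤ n g + (g (suc n) + h (suc (suc n))) ≈⟨ +-assoc _ _ _ ⟨
    Σ≤ n g + g (suc n) + h (suc (suc n)) ∎

  ΣFromTo-zero : ∀ N f → ΣFromTo 0 N f ≈ Σ≤ N f
  ΣFromTo-zero zero    f = refl
  ΣFromTo-zero (suc N) f = +-congʳ (ΣFromTo-zero N f)

  ΣFromTo-suc : ∀ k N f → ΣFromTo (suc k) (suc N) f ≈ ΣFromTo k N (λ i → f (suc i))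
  ΣFromTo-suc zero    zero    f = +-identityˡ _
  ΣFromTo-suc (suc k) zero    f = +-identityˡ _
  ΣFromTo-suc k       (suc N) f = +-congʳ (ΣFromTo-suc k N f)

  ΣFromTo≈Σ≤ : ∀ k N f → (∀ i → i < k → f i ≈ 0#) → ΣFromTo k N f ≈ Σ≤ N f
  ΣFromTo≈Σ≤ zero    N       f _   = ΣFromTo-zero N f
  ΣFromTo≈Σ≤ (suc k) zero    f f≈0 = sym (f≈0 0 (s≤s z≤n))
  ΣFromTo≈Σ≤ (suc k) (suc N) f f≈0 = begin
    ΣFromTo (suc k) (suc N) f          ≈⟨ ΣFromTo-suc k N f ⟩
    ΣFromTo k N (λ i → f (suc i))      ≈⟨ ΣFromTo≈Σ≤ k N _ (λ i i<k → f≈0 (suc i) (s≤s i<k)) ⟩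
    Σ≤ N (λ i → f (suc i))             ≈⟨ +-identityˡ _ ⟨
    0# + Σ≤ N (λ i → f (suc i))        ≈⟨ +-congʳ (f≈0 0 (s≤s z≤n)) ⟨
    f 0 + Σ≤ N (λ i → f (suc i))       ≈⟨ Σ≤-head N f ⟨
    Σ≤ (suc N) f                       ∎

  ⊛-lin-suc : ∀ p u v k → (p ⊛ lin u v) (suc k) ≈ p k * v + p (suc k) * u
  ⊛-lin-suc p u v k = +-cong
    (trans (Σ≤-last k (λ i i<k → trans (*-congˡ (≈-at (lin u v) (+-∸-assoc 2 i<k))) (zeroʳ _)))
           (*-congˡ (≈-at (lin u v) (m+n∸n≡m 1 k))))
    (*-congˡ (≈-at (lin u v) (n∸n≡0 k)))

  ⊛-lin-vanishes : ∀ {n} p u v → (∀ m → n < m → p m ≈ 0#) →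
                   ∀ m → suc n < m → (p ⊛ lin u v) m ≈ 0#
  ⊛-lin-vanishes p u v p≈0 (suc k) (s≤s n<k) = begin
    (p ⊛ lin u v) (suc k)   ≈⟨ ⊛-lin-suc p u v k ⟩
    p k * v + p (suc k) * u ≈⟨ +-cong (*-congʳ (p≈0 k n<k)) (*-congʳ (p≈0 (suc k) (m<n⇒m<1+n n<k))) ⟩
    0# * v + 0# * u         ≈⟨ +-cong (zeroˡ v) (zeroˡ u) ⟩
    0# + 0#                 ≈⟨ +-identityʳ 0# ⟩
    0#                      ∎

  -- Coefficientwise form of (1 + a y) · p y/(1 + a y) = y p.
  ⊛-invShift-suc : ∀ a p N → (p ⊛ invShift a) (suc N) + a * (p ⊛ invShift a) N ≈ p N
  ⊛-invShift-suc a p N = begin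
    Σ≤ N (λ j → p j * s (suc N ∸ j)) + p (suc N) * s (N ∸ N) + a * Σ≤ N (λ j → p j * s (N ∸ j))
      ≈⟨ +-cong (trans (+-congˡ (trans (*-congˡ (≈-at s (n∸n≡0 N))) (zeroʳ _))) (+-identityʳ _))
                (*-distribˡ-Σ≤ N a _) ⟩
    Σ≤ N (λ j → p j * s (suc N ∸ j)) + Σ≤ N (λ j → a * (p j * s (N ∸ j)))
      ≈⟨ Σ≤-+ N _ _ ⟨
    Σ≤ N (λ j → p j * s (suc N ∸ j) + a * (p j * s (N ∸ j)))
      ≈⟨ Σ≤-cong N (λ j j≤N → trans (+-cong (*-congˡ (≈-at s (+-∸-assoc 1 j≤N))) (x∙yz≈y∙xz _ _ _))
                                    (sym (distribˡ _ _ _))) ⟩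
    Σ≤ N (λ j → p j * e (N ∸ j))
      ≈⟨ Σ≤-last N (λ j j<N →
           trans (*-congˡ (trans (≈-at e (+-∸-assoc 1 j<N)) (e-suc (N ∸ suc j)))) (zeroʳ _)) ⟩
    p N * e (N ∸ N)
      ≈⟨ *-congˡ (trans (≈-at e (n∸n≡0 N)) e-zero) ⟩
    p N * 1#
      ≈⟨ *-identityʳ _ ⟩
    p N ∎
    where
    s : Ser
    s = invShift a
    e : ℕ → Carrier
    e m = s (suc m) + a * s m
    e-zero : e 0 ≈ 1#
    e-zero = trans (+-congˡ (zeroʳ a)) (+-identityʳ 1#)
    e-suc : ∀ m → e (suc m) ≈ 0#
    e-suc m = trans (sym (distribʳ _ _ _)) (trans (*-congʳ (-‿inverseˡ a)) (zeroˡ _))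

  -1*s*[-a*b]≈a*[s*b] : ∀ s a b → (- 1# * s) * (- a * b) ≈ a * (s * b)
  -1*s*[-a*b]≈a*[s*b] s a b = begin
    (- 1# * s) * (- a * b)  ≈⟨ *-cong (-1*x≈-x s) (sym (-‿distribˡ-* a b)) ⟩
    - s * - (a * b)         ≈⟨ -‿distribˡ-* s _ ⟨
    - (s * - (a * b))       ≈⟨ -‿cong (-‿distribʳ-* s _) ⟨
    - - (s * (a * b))       ≈⟨ -‿involutive _ ⟩
    s * (a * b)             ≈⟨ x∙yz≈y∙xz _ _ _ ⟩
    a * (s * b)             ∎

  module _ (lam : Carrier) where

    rising-vanishes : ∀ {n k} → n < k → rising lam n k ≈ 0#
    rising-vanishes {zero}  {suc k} _   = refl
    rising-vanishes {suc n} {k}     n<k =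
      ⊛-lin-vanishes (rising lam n) _ 1# (λ m → rising-vanishes) k n<k

    falling-vanishes : ∀ {n k} → n < k → falling lam n k ≈ 0#
    falling-vanishes {zero}  {suc k} _   = refl
    falling-vanishes {suc n} {k}     n<k =
      ⊛-lin-vanishes (falling lam n) _ 1# (λ m → falling-vanishes) k n<k

    rising-suc-zero : ∀ n → rising lam (suc n) 0 ≈ 0#
    rising-suc-zero zero    = zeroʳ _
    rising-suc-zero (suc n) = trans (*-congʳ (rising-suc-zero n)) (zeroˡ _)

    rising-suc-suc : ∀ n k → rising lam (suc n) (suc k) ≈ rising lam n k + n · lam * rising lam n (suc k)
    rising-suc-suc n k = trans (⊛-lin-suc _ _ _ k) (+-cong (*-identityʳ _) (*-comm _ _))

    signedS1≈uS1 : ∀ n k → (- 1#) ^ (n ∸ k) * S1 lam n k ≈ uS1 lam n k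
    signedS1≈uS1 zero    zero    = *-identityˡ _
    signedS1≈uS1 zero    (suc k) = *-identityˡ _
    signedS1≈uS1 (suc n) zero    = begin
      (- 1#) ^ suc n * (falling lam n 0 * - (n · lam)) ≈⟨ *-congˡ (*-comm _ _) ⟩
      (- 1#) ^ suc n * (- (n · lam) * falling lam n 0) ≈⟨ -1*s*[-a*b]≈a*[s*b] _ _ _ ⟩
      n · lam * ((- 1#) ^ n * falling lam n 0)         ≈⟨ *-congˡ (signedS1≈uS1 n zero) ⟩
      n · lam * rising lam n 0                         ≈⟨ *-comm _ _ ⟩
      rising lam n 0 * n · lam                         ∎
    signedS1≈uS1 (suc n) (suc k) = begin
      (- 1#) ^ (n ∸ k) * falling lam (suc n) (suc k)
        ≈⟨ *-congˡ (⊛-lin-suc _ _ _ k) ⟩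
      (- 1#) ^ (n ∸ k) * (falling lam n k * 1# + falling lam n (suc k) * - (n · lam))
        ≈⟨ *-congˡ (+-cong (*-identityʳ _) (*-comm _ _)) ⟩
      (- 1#) ^ (n ∸ k) * (falling lam n k + - (n · lam) * falling lam n (suc k))
        ≈⟨ distribˡ _ _ _ ⟩
      (- 1#) ^ (n ∸ k) * falling lam n k + (- 1#) ^ (n ∸ k) * (- (n · lam) * falling lam n (suc k))
        ≈⟨ +-cong (signedS1≈uS1 n k) higher ⟩
      rising lam n k + n · lam * rising lam n (suc k)
        ≈⟨ rising-suc-suc n k ⟨
      rising lam (suc n) (suc k) ∎
      where
      -- n ∸ k is truncated; when n ≤ k both sides vanish instead.
      higher : (- 1#) ^ (n ∸ k) * (- (n · lam) * falling lam n (suc k)) ≈ n · lam * rising lam n (suc k)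
      higher with suc k ≤? n
      ... | yes k<n = trans (*-congʳ (≈-at ((- 1#) ^_) (+-∸-assoc 1 k<n)))
                            (trans (-1*s*[-a*b]≈a*[s*b] _ _ _) (*-congˡ (signedS1≈uS1 n (suc k))))
      ... | no k≮n  = begin
        (- 1#) ^ (n ∸ k) * (- (n · lam) * falling lam n (suc k))
          ≈⟨ *-congˡ (*-congˡ (falling-vanishes (≰⇒> k≮n))) ⟩
        (- 1#) ^ (n ∸ k) * (- (n · lam) * 0#)
          ≈⟨ trans (*-congˡ (zeroʳ _)) (zeroʳ _) ⟩
        0#
          ≈⟨ trans (*-congˡ (rising-vanishes (≰⇒> k≮n))) (zeroʳ _) ⟨
        n · lam * rising lam n (suc k) ∎

    invRising-suc : ∀ n N →
      invRising lam (suc n) (suc N) + suc n · lam * invRising lam (suc n) N ≈ invRising lam n N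
    invRising-suc n = ⊛-invShift-suc (suc n · lam) (invRising lam n)

    invRising-vanishes : ∀ n N → N ≤ n → invRising lam n N ≈ 0#
    invRising-vanishes zero    zero    _         = refl
    invRising-vanishes (suc n) zero    _         = zeroʳ _
    invRising-vanishes (suc n) (suc N) (s≤s N≤n) = begin
      invRising lam (suc n) (suc N)
        ≈⟨ +-identityʳ _ ⟨
      invRising lam (suc n) (suc N) + 0#
        ≈⟨ +-congˡ (trans (*-congˡ (invRising-vanishes (suc n) N (m≤n⇒m≤1+n N≤n))) (zeroʳ _)) ⟨
      invRising lam (suc n) (suc N) + suc n · lam * invRising lam (suc n) N
        ≈⟨ invRising-suc n N ⟩
      invRising lam n N
        ≈⟨ invRising-vanishes n N N≤n ⟩
      0# ∎

    -- The coefficient of y^N in G k, truncated at n ≤ N since F n has order n+1.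
    stirlingSum : ℕ → Ser
    stirlingSum k N = Σ≤ N (λ n → uS1 lam n k * invRising lam n N)

    stirlingSum-zero : ∀ N → stirlingSum 0 N ≈ mono 1 N
    stirlingSum-zero N =
      trans (Σ≤-first N (λ n _ → trans (*-congʳ (rising-suc-zero n)) (zeroˡ _)))
            (trans (*-identityˡ _) (F0≈mono1 N))
      where
      F0≈mono1 : ∀ N → invRising lam 0 N ≈ mono 1 N
      F0≈mono1 zero          = refl
      F0≈mono1 (suc zero)    = refl
      F0≈mono1 (suc (suc m)) = trans (sym (-‿distribˡ-* _ _)) (trans (-‿cong (zeroˡ _)) -0#≈0#)

    stirlingSum-suc : ∀ k N → stirlingSum k N ≈ stirlingSum (suc k) (suc N)
    stirlingSum-suc k N = begin
      Σ≤ N f                 ≈⟨ trans (+-congˡ (zeroˡ _)) (+-identityʳ _) ⟨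
      Σ≤ N f + h 0           ≈⟨ Σ≤-telescope N f g h step ⟩
      Σ≤ N g + h (suc N)     ≈⟨ trans (+-congˡ h-last) (+-identityʳ _) ⟩
      Σ≤ N g                 ≈⟨ trans (+-congʳ (zeroˡ _)) (+-identityˡ _) ⟨
      uS1 lam 0 (suc k) * invRising lam 0 (suc N) + Σ≤ N g
                             ≈⟨ Σ≤-head N _ ⟨
      stirlingSum (suc k) (suc N) ∎
      where
      F : ℕ → Carrier
      F n = invRising lam n N
      f g h : ℕ → Carrier
      f n = rising lam n k * F n
      g n = rising lam (suc n) (suc k) * invRising lam (suc n) (suc N)
      h n = n · lam * (rising lam n (suc k) * F n)
      h-last : h (suc N) ≈ 0#
      h-last = trans (*-congˡ (trans (*-congˡ (invRising-vanishes (suc N) N (n≤1+n N))) (zeroʳ _))) (zeroʳ _)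
      step : ∀ i → f i + h i ≈ g i + h (suc i)
      step i = begin
        rising lam i k * F i + i · lam * (rising lam i (suc k) * F i)
          ≈⟨ +-congˡ (*-assoc _ _ _) ⟨
        rising lam i k * F i + i · lam * rising lam i (suc k) * F i
          ≈⟨ distribʳ _ _ _ ⟨
        (rising lam i k + i · lam * rising lam i (suc k)) * F i
          ≈⟨ *-congʳ (rising-suc-suc i k) ⟨
        rising lam (suc i) (suc k) * F i
          ≈⟨ *-congˡ (invRising-suc i N) ⟨
        rising lam (suc i) (suc k) * (invRising lam (suc i) (suc N) + suc i · lam * F (suc i))
          ≈⟨ distribˡ _ _ _ ⟩
        g i + rising lam (suc i) (suc k) * (suc i · lam * F (suc i))
          ≈⟨ +-congˡ (x∙yz≈y∙xz _ _ _) ⟩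
        g i + h (suc i) ∎

    stirlingSum≈mono : ∀ k N → stirlingSum k N ≈ mono (suc k) N
    stirlingSum≈mono zero    N       = stirlingSum-zero N
    stirlingSum≈mono (suc k) zero    = zeroˡ _
    stirlingSum≈mono (suc k) (suc N) = trans (sym (stirlingSum-suc k N)) (stirlingSum≈mono k N)

    uS1-expansion : ∀ k N → sumFrom k (λ n → uS1 lam n k) (invRising lam) N ≈ mono (suc k) N
    uS1-expansion k N = begin
      sumFrom k (λ n → uS1 lam n k) (invRising lam) N
        ≈⟨ ΣFromTo≈Σ≤ k N _ (λ n n<k → trans (*-congʳ (rising-vanishes n<k)) (zeroˡ _)) ⟩
      stirlingSum k N
        ≈⟨ stirlingSum≈mono k N ⟩
      mono (suc k) N ∎

    signedS1-expansion : ∀ k N →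
      sumFrom k (λ n → (- 1#) ^ (n ∸ k) * S1 lam n k) (invRising lam) N ≈ mono (suc k) N
    signedS1-expansion k N = begin
      sumFrom k (λ n → (- 1#) ^ (n ∸ k) * S1 lam n k) (invRising lam) N
        ≈⟨ ΣFromTo≈Σ≤ k N _ (λ n n<k →
             trans (*-congʳ (trans (signedS1≈uS1 n k) (rising-vanishes n<k))) (zeroˡ _)) ⟩
      Σ≤ N (λ n → (- 1#) ^ (n ∸ k) * S1 lam n k * invRising lam n N)
        ≈⟨ Σ≤-cong N (λ n _ → *-congʳ (signedS1≈uS1 n k)) ⟩
      stirlingSum k N
        ≈⟨ stirlingSum≈mono k N ⟩
      mono (suc k) N ∎

corollary4 : ∀ {c ℓ} (R : CommutativeRing c ℓ) (lam : CommutativeRing.Carrier R) (k : ℕ) →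
    let open CommutativeRing R
        open Series R
    in (∀ N → sumFrom k (λ n → ((- 1#) ^ (n ∸ k)) * S1 lam n k) (invRising lam) N ≈ mono (suc k) N)
       × (∀ N → sumFrom k (λ n → uS1 lam n k) (invRising lam) N ≈ mono (suc k) N)
corollary4 R lam k = signedS1-expansion R lam k , uS1-expansion R lam k
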